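{- Let $\operatorname{OBJ}(\overline{\mathrm{GW}})$ and $\operatorname{OBJ}(\overline{\mathrm{DW}})$ denote the optimal objective function values of the LP relaxations of the MILP formulations GW and DW of QUBO described below. Then $\operatorname{OBJ}(\overline{\mathrm{GW}})\leq\operatorname{OBJ}(\overline{\mathrm{DW}})$ for every instance. Further, $\operatorname{OBJ}(\overline{\mathrm{DW}})$ could be arbitrarily bad (i.e. arbitrarily larger, for this maximization problem) compared to $\operatorname{OBJ}(\overline{\mathrm{GW}})$.
   Context: QUBO: maximize $\sum_{i=1}^n\sum_{j\in R_i}q_{ij}x_ix_j+\sum_{i=1}^n c_ix_i$ over $x\in\{0,1\}^n$, where $Q=(q_{ij})$ is an $n\times n$ symmetric matrix with zero diagonal, $c\in\mathbb{R}^n$, and $R_i=\{j: q_{ij}\neq 0\}$. DW (Dantzig–Watters) formulation: maximize $\sum_{i}\sum_{j\in R_i}q_{ij}y_{ij}+\sum_i c_ix_i$ subject to $x_i+x_j-y_{ij}\leq 1$ and $2y_{ij}-x_i-x_j\leq 0$ for all $j\in R_i$, $i=1,\ldots,n$; $x_i\in\{0,1\}$; $y_{ij}\in\{0,1\}$. GW (Glover–Woolsey / standard linearization): maximize the same objective subject to $x_i+x_j-y_{ij}\leq 1$, $y_{ij}\leq x_i$ and $y_{ij}\leq x_j$ for all $j\in R_i$, $i=1,\ldots,n$; $x_i\in\{0,1\}$; $y_{ij}\geq 0$. The LP relaxation $\overline{P}$ of a model $P$ is obtained by replacing each binary restriction by the bounds $0\le\cdot\le 1$; $\operatorname{OBJ}(\overline{P})$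 is its optimal value.
   Formalization: The matrix Q and the vector c have rational entries instead of real ones, and the optimal values of the LP relaxations are taken over points with rational coordinates. -}

module Defs where

open import Data.Nat using (ℕ; zero; suc)
open import Data.Fin using (Fin; zero; suc)
open import Data.Rational using (ℚ; 0ℚ; 1ℚ; _+_; _*_; _-_; _≤_)
open import Data.Product using (Σ; _×_; _,_)
open import Relation.Binary.PropositionalEquality using (_≡_)
open import Relation.Nullary using (¬_)

sumFin : (n : ℕ) → (Fin n → ℚ) → ℚ
sumFin zero    f = 0ℚ
sumFin (suc n) f = f zero + sumFin n (λ i → f (suc i))

record Instance (n : ℕ) : Set where
  field
    Q    : Fin n → Fin n → ℚ
    c    : Fin n → ℚ
    sym  : ∀ i j → Q i j ≡ Q j i
    diag : ∀ i → Q i i ≡ 0ℚ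

open Instance public

-- A point (x, y); y_ij is only meaningful for j ∈ R_i (it is
-- unconstrained and has zero objective coefficient otherwise).
Point : ℕ → Set
Point n = (Fin n → ℚ) × (Fin n → Fin n → ℚ)

objective : {n : ℕ} → Instance n → Point n → ℚ
objective {n} I (x , y) =
  sumFin n (λ i → sumFin n (λ j → Q I i j * y i j)) + sumFin n (λ i → c I i * x i)

DWbar : {n : ℕ} → Instance n → Point n → Set
DWbar {n} I (x , y) =
  (∀ i → (0ℚ ≤ x i) × (x i ≤ 1ℚ)) ×
  (∀ i j → ¬ (Q I i j ≡ 0ℚ) →
     ((x i + x j) - y i j ≤ 1ℚ) ×
     (((y i j + y i j) - x i) - x j ≤ 0ℚ) ×
     (0ℚ ≤ y i j) × (y i j ≤ 1ℚ))

GWbar : {n : ℕ} → Instance n → Point n → Set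
GWbar {n} I (x , y) =
  (∀ i → (0ℚ ≤ x i) × (x i ≤ 1ℚ)) ×
  (∀ i j → ¬ (Q I i j ≡ 0ℚ) →
     ((x i + x j) - y i j ≤ 1ℚ) ×
     (y i j ≤ x i) × (y i j ≤ x j) × (0ℚ ≤ y i j))

IsOptimalValue : {n : ℕ} → Instance n → (Point n → Set) → ℚ → Set
IsOptimalValue {n} I F v =
  Σ (Point n) (λ p → F p × (objective I p ≡ v)) ×
  (∀ p → F p → objective I p ≤ v)

OBJ-GWbar : {n : ℕ} → Instance n → ℚ → Set
OBJ-GWbar I = IsOptimalValue I (GWbar I)

OBJ-DWbar : {n : ℕ} → Instance n → ℚ → Set
OBJ-DWbar I = IsOptimalValue I (DWbar I)

{-# OPTIONS --safe #-}
-- A GW-feasible point is DW-feasible, since y ≤ xᵢ and y ≤ xⱼ give 2y ≤ xᵢ + xⱼ; hence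
-- OBJ(GW̄) ≤ OBJ(DW̄). For the gap take n = 2, q₀₁ = q₁₀ = t > 0, c = (−2t, 0), with objective
-- t(y₀₁ + y₁₀) − 2t x₀. GW forces y₀₁, y₁₀ ≤ x₀, so its value is 0. DW only forces
-- 2y₀₁, 2y₁₀ ≤ x₀ + x₁, which x = (0, 1), y = ½ meets with value t; and t is optimal, because
-- twice the objective is t(2y₀₁ − x₀ − x₁) + t(2y₁₀ − x₁ − x₀) + 2t(x₁ − x₀) ≤ 2t.
module Submission where

open import Defs
open import Data.Nat using (ℕ)
open import Data.Rational using (ℚ; _+_; _≤_)
open import Data.Product using (Σ; _×_)

open import Data.Unit using (tt)
open import Data.Fin using (Fin; zero; suc)
open import Data.Product using (_,_; proj₁; proj₂)
open import Data.Rational using (0ℚ; 1ℚ; ½; _*_; _-_; -_; _⊔_; _<_; _≤?_; NonNegative; nonNegative)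
open import Data.Rational.Properties
open import Data.Rational.Solver using (module +-*-Solver)
open import Relation.Binary.PropositionalEquality as ≡ using (_≡_; _≢_; refl; subst; ≢-sym)
open import Relation.Nullary using (contradiction)
open import Relation.Nullary.Decidable using (True; toWitness)
open import Relation.Unary using (_⊆_)
open +-*-Solver

≤-decide : {p q : ℚ} → True (p ≤? q) → p ≤ q
≤-decide = toWitness

p+p≤q+q⇒p≤q : {p q : ℚ} → p + p ≤ q + q → p ≤ q
p+p≤q+q⇒p≤q h = ≮⇒≥ (λ q<p → <-irrefl refl (<-≤-trans (+-mono-< q<p q<p) h))

IsOptimalValue-mono : ∀ {n} (I : Instance n) {F G : Point n → Set} {v w : ℚ} →
  F ⊆ G → IsOptimalValue I F v → IsOptimalValue I G w → v ≤ w
IsOptimalValue-mono I F⊆G ((p , p∈F , objp≡v) , _) (_ , G≤w) =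
  subst (_≤ _) objp≡v (G≤w p (F⊆G p∈F))

GWbar⊆DWbar : ∀ {n} (I : Instance n) → GWbar I ⊆ DWbar I
GWbar⊆DWbar I {x , y} (x-bounds , y-bounds) = x-bounds , λ i j q≢0 →
  let (lower , y≤xᵢ , y≤xⱼ , 0≤y) = y-bounds i j q≢0 in
  lower , 2y-xᵢ-xⱼ≤0 i j y≤xᵢ y≤xⱼ , 0≤y , ≤-trans y≤xᵢ (proj₂ (x-bounds i))
  where
  open ≤-Reasoning
  2y-xᵢ-xⱼ≤0 : ∀ i j → y i j ≤ x i → y i j ≤ x j → ((y i j + y i j) - x i) - x j ≤ 0ℚ
  2y-xᵢ-xⱼ≤0 i j y≤xᵢ y≤xⱼ = begin
    ((y i j + y i j) - x i) - x j ≤⟨ +-monoˡ-≤ (- x j) (+-monoˡ-≤ (- x i) (+-mono-≤ y≤xᵢ y≤xⱼ)) ⟩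
    ((x i + x j) - x i) - x j     ≡⟨ solve 2 (λ a b → ((a :+ b) :- a) :- b := con 0ℚ) refl (x i) (x j) ⟩
    0ℚ                            ∎

gapQ : ℚ → Fin 2 → Fin 2 → ℚ
gapQ t zero       (suc zero) = t
gapQ t (suc zero) zero       = t
gapQ t _          _          = 0ℚ

gapInstance : ℚ → Instance 2
gapInstance t = record
  { Q    = gapQ t
  ; c    = λ { zero → - (t + t) ; (suc zero) → 0ℚ }
  ; sym  = λ { zero zero → refl ; zero (suc zero) → refl
             ; (suc zero) zero → refl ; (suc zero) (suc zero) → refl }
  ; diag = λ { zero → refl ; (suc zero) → refl }
  }

objective-gapInstance : ∀ t (x : Fin 2 → ℚ) (y : Fin 2 → Fin 2 → ℚ) →
  objective (gapInstance t) (x , y) ≡ t * (y zero (suc zero) + y (suc zero) zero) - (t + t) * x zero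
objective-gapInstance t x y = solve 7
  -- the left-hand side is `objective (gapInstance t) (x , y)` with `sumFin 2` unfolded
  (λ t x₀ x₁ y₀₀ y₀₁ y₁₀ y₁₁ →
     ((con 0ℚ :* y₀₀ :+ (t :* y₀₁ :+ con 0ℚ)) :+ ((t :* y₁₀ :+ (con 0ℚ :* y₁₁ :+ con 0ℚ)) :+ con 0ℚ))
       :+ ((:- (t :+ t)) :* x₀ :+ (con 0ℚ :* x₁ :+ con 0ℚ))
     := t :* (y₀₁ :+ y₁₀) :- (t :+ t) :* x₀)
  refl t (x zero) (x (suc zero)) (y zero zero) (y zero (suc zero)) (y (suc zero) zero) (y (suc zero) (suc zero))

module _ (t : ℚ) (0<t : 0ℚ < t) where
  private
    instance
      t-nonNeg : NonNegative t
      t-nonNeg = nonNegative (<⇒≤ 0<t)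

    t≢0 : t ≢ 0ℚ
    t≢0 = ≢-sym (<⇒≢ 0<t)

  open ≤-Reasoning

  GWbar-gapInstance-≤0 : ∀ p → GWbar (gapInstance t) p → objective (gapInstance t) p ≤ 0ℚ
  GWbar-gapInstance-≤0 (x , y) (_ , y-bounds) = begin
    objective (gapInstance t) (x , y) ≡⟨ objective-gapInstance t x y ⟩
    t * (y₀₁ + y₁₀) - (t + t) * x₀    ≤⟨ +-monoˡ-≤ _ (*-monoˡ-≤-nonNeg t (+-mono-≤ y₀₁≤x₀ y₁₀≤x₀)) ⟩
    t * (x₀ + x₀) - (t + t) * x₀      ≡⟨ solve 2 (λ t x₀ → t :* (x₀ :+ x₀) :- (t :+ t) :* x₀ := con 0ℚ) refl t x₀ ⟩
    0ℚ                                ∎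
    where
    x₀ y₀₁ y₁₀ : ℚ
    x₀ = x zero
    y₀₁ = y zero (suc zero)
    y₁₀ = y (suc zero) zero
    y₀₁≤x₀ : y₀₁ ≤ x₀
    y₀₁≤x₀ = proj₁ (proj₂ (y-bounds zero (suc zero) t≢0))
    y₁₀≤x₀ : y₁₀ ≤ x₀
    y₁₀≤x₀ = proj₁ (proj₂ (proj₂ (y-bounds (suc zero) zero t≢0)))

  DWbar-gapInstance-≤t : ∀ p → DWbar (gapInstance t) p → objective (gapInstance t) p ≤ t
  DWbar-gapInstance-≤t (x , y) (x-bounds , y-bounds) =
    subst (_≤ t) (≡.sym (objective-gapInstance t x y)) (p+p≤q+q⇒p≤q (begin
      f + f                                               ≡⟨ f+f≡ ⟩
      (t * a₀₁ + t * a₁₀) + (t * Δx + t * Δx)             ≤⟨ +-mono-≤ (+-mono-≤ (t*-mono a₀₁≤0) (t*-mono a₁₀≤0))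
                                                                      (+-mono-≤ (t*-mono Δx≤1) (t*-mono Δx≤1)) ⟩
      (t * 0ℚ + t * 0ℚ) + (t * (1ℚ - 0ℚ) + t * (1ℚ - 0ℚ)) ≡⟨ bound≡t+t ⟩
      t + t                                               ∎))
    where
    x₀ x₁ y₀₁ y₁₀ f a₀₁ a₁₀ Δx : ℚ
    x₀ = x zero
    x₁ = x (suc zero)
    y₀₁ = y zero (suc zero)
    y₁₀ = y (suc zero) zero
    f = t * (y₀₁ + y₁₀) - (t + t) * x₀
    a₀₁ = ((y₀₁ + y₀₁) - x₀) - x₁
    a₁₀ = ((y₁₀ + y₁₀) - x₁) - x₀
    Δx = x₁ - x₀

    f+f≡ : f + f ≡ (t * a₀₁ + t * a₁₀) + (t * Δx + t * Δx)
    f+f≡ = solve 5 (λ t x₀ x₁ y₀₁ y₁₀ →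
        let f = t :* (y₀₁ :+ y₁₀) :- (t :+ t) :* x₀ in
        f :+ f := (t :* (((y₀₁ :+ y₀₁) :- x₀) :- x₁) :+ t :* (((y₁₀ :+ y₁₀) :- x₁) :- x₀))
                  :+ (t :* (x₁ :- x₀) :+ t :* (x₁ :- x₀)))
      refl t x₀ x₁ y₀₁ y₁₀

    bound≡t+t : (t * 0ℚ + t * 0ℚ) + (t * (1ℚ - 0ℚ) + t * (1ℚ - 0ℚ)) ≡ t + t
    bound≡t+t = solve 1 (λ t →
        (t :* con 0ℚ :+ t :* con 0ℚ) :+ (t :* (con 1ℚ :- con 0ℚ) :+ t :* (con 1ℚ :- con 0ℚ)) := t :+ t)
      refl t

    t*-mono : ∀ {p q} → p ≤ q → t * p ≤ t * q
    t*-mono = *-monoˡ-≤-nonNeg t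

    a₀₁≤0 : a₀₁ ≤ 0ℚ
    a₀₁≤0 = proj₁ (proj₂ (y-bounds zero (suc zero) t≢0))
    a₁₀≤0 : a₁₀ ≤ 0ℚ
    a₁₀≤0 = proj₁ (proj₂ (y-bounds (suc zero) zero t≢0))
    Δx≤1 : Δx ≤ 1ℚ - 0ℚ
    Δx≤1 = +-mono-≤ (proj₂ (x-bounds (suc zero))) (neg-antimono-≤ (proj₁ (x-bounds zero)))

  OBJ-GWbar-gapInstance : OBJ-GWbar (gapInstance t) 0ℚ
  OBJ-GWbar-gapInstance = ((x , y) , feasible , value) , GWbar-gapInstance-≤0
    where
    x : Fin 2 → ℚ
    x _ = 0ℚ
    y : Fin 2 → Fin 2 → ℚ
    y _ _ = 0ℚ
    feasible : GWbar (gapInstance t) (x , y)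
    feasible = (λ _ → ≤-decide tt , ≤-decide tt) ,
               λ _ _ _ → ≤-decide tt , ≤-decide tt , ≤-decide tt , ≤-decide tt
    value : objective (gapInstance t) (x , y) ≡ 0ℚ
    value = ≡.trans (objective-gapInstance t x y)
      (solve 1 (λ t → t :* (con 0ℚ :+ con 0ℚ) :- (t :+ t) :* con 0ℚ := con 0ℚ) refl t)

  OBJ-DWbar-gapInstance : OBJ-DWbar (gapInstance t) t
  OBJ-DWbar-gapInstance = ((x , y) , feasible , value) , DWbar-gapInstance-≤t
    where
    x : Fin 2 → ℚ
    x zero       = 0ℚ
    x (suc zero) = 1ℚ
    y : Fin 2 → Fin 2 → ℚ
    y _ _ = ½
    feasible : DWbar (gapInstance t) (x , y)
    feasible = x-bounds , y-bounds
      where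
      x-bounds : ∀ i → (0ℚ ≤ x i) × (x i ≤ 1ℚ)
      x-bounds zero       = ≤-decide tt , ≤-decide tt
      x-bounds (suc zero) = ≤-decide tt , ≤-decide tt
      y-bounds : ∀ i j → gapQ t i j ≢ 0ℚ →
        ((x i + x j) - y i j ≤ 1ℚ) × (((y i j + y i j) - x i) - x j ≤ 0ℚ) × (0ℚ ≤ y i j) × (y i j ≤ 1ℚ)
      y-bounds zero       zero       q≢0 = contradiction refl q≢0
      y-bounds zero       (suc zero) _   = ≤-decide tt , ≤-decide tt , ≤-decide tt , ≤-decide tt
      y-bounds (suc zero) zero       _   = ≤-decide tt , ≤-decide tt , ≤-decide tt , ≤-decide tt
      y-bounds (suc zero) (suc zero) q≢0 = contradiction refl q≢0
    value : objective (gapInstance t) (x , y) ≡ t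
    value = ≡.trans (objective-gapInstance t x y)
      (solve 1 (λ t → t :* (con ½ :+ con ½) :- (t :+ t) :* con 0ℚ := t) refl t)

theorem22 : ((n : ℕ) (I : Instance n) (vG vD : ℚ) →
                 OBJ-GWbar I vG → OBJ-DWbar I vD → vG ≤ vD)
              × ((M : ℚ) → Σ ℕ (λ n → Σ (Instance n) (λ I → Σ ℚ (λ vG → Σ ℚ (λ vD →
                   OBJ-GWbar I vG × OBJ-DWbar I vD × (vG + M ≤ vD))))))
theorem22 = (λ n I vG vD → IsOptimalValue-mono I (GWbar⊆DWbar I)) , λ M →
  let t   = 1ℚ ⊔ M
      0<t = <-≤-trans (positive⁻¹ 1ℚ) (p≤p⊔q 1ℚ M)
  in  2 , gapInstance t , 0ℚ , t , OBJ-GWbar-gapInstance t 0<t , OBJ-DWbar-gapInstance t 0<t ,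
      subst (_≤ t) (≡.sym (+-identityˡ M)) (p≤q⊔p 1ℚ M)
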